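{- Let $k\geq1$, $n\geq1$ and $1\leq j\leq n$. The number of $k$-box paths of size $n$ with exactly $j$ long ascents is \[\acute{f}_{k,n,j}=\frac{1}{j}\binom{(k+1)n-2}{j-1}\binom{n-1}{j-1}.\]
   Context: A skew Dyck path is a word $w$ over $\{U,D,L\}$ such that: $w$ contains neither $UL$ nor $LU$ as a contiguous subword; the number of $U$s equals the total number of $D$s and $L$s; and in every prefix the total number of $D$s and $L$s is at most the number of $U$s. Its semilength is its number of $U$s. A factor is a contiguous subword; $X^{m}$ denotes $m$ consecutive copies of $X$. For $k\geq1$, a $k$-box path of size $n$ is a skew Dyck path of semilength $(k+2)n-1$ containing exactly $n$ occurrences of the factor $UD^{k}L$. An ascent is a maximal run of consecutive $U$s; a long ascent is an ascent consisting of at least two $U$s. -}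

module Defs where

open import Data.Nat using (ℕ; zero; suc; _+_; _*_; _∸_; _≡ᵇ_; _≤ᵇ_)
open import Data.Bool using (Bool; true; false; _∧_; not; if_then_else_)
open import Data.List using (List; []; _∷_; length; filterᵇ; concatMap; replicate; _++_)

data Step : Set where
  U D L : Step

Word : Set
Word = List Step

isU : Step → Bool
isU U = true
isU _ = false

stepEq : Step → Step → Bool
stepEq U U = true
stepEq D D = true
stepEq L L = true
stepEq _ _ = false

allWords : ℕ → List Word
allWords zero = [] ∷ []
allWords (suc n) = concatMap (λ w → (U ∷ w) ∷ (D ∷ w) ∷ (L ∷ w) ∷ []) (allWords n)

noULLU : Word → Bool
noULLU (U ∷ L ∷ _) = false
noULLU (L ∷ U ∷ _) = false
noULLU (_ ∷ w) = noULLU w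
noULLU [] = true

heightOK : ℕ → Word → Bool
heightOK h [] = h ≡ᵇ 0
heightOK h (U ∷ w) = heightOK (suc h) w
heightOK zero (D ∷ w) = false
heightOK (suc h) (D ∷ w) = heightOK h w
heightOK zero (L ∷ w) = false
heightOK (suc h) (L ∷ w) = heightOK h w

isSkewDyck : Word → Bool
isSkewDyck w = noULLU w ∧ heightOK 0 w

count : Step → Word → ℕ
count s [] = 0
count s (t ∷ w) = if stepEq s t then suc (count s w) else count s w

semilength : Word → ℕ
semilength = count U

isPrefix : Word → Word → Bool
isPrefix [] _ = true
isPrefix (_ ∷ _) [] = false
isPrefix (a ∷ p) (b ∷ w) = stepEq a b ∧ isPrefix p w

occurrences : Word → Word → ℕ
occurrences p [] = if isPrefix p [] then 1 else 0
occurrences p (a ∷ w) = (if isPrefix p (a ∷ w) then 1 else 0) + occurrences p w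

boxFactor : ℕ → Word
boxFactor k = U ∷ (replicate k D ++ (L ∷ []))

-- Number of long ascents: maximal runs of U's of length ≥ 2.
-- A long ascent starts at a position where "UU" begins and which is not
-- preceded by U.  'prevU' records whether the previous letter was U.
longAscentsFrom : Bool → Word → ℕ
longAscentsFrom _ [] = 0
longAscentsFrom false (U ∷ U ∷ w) = suc (longAscentsFrom true (U ∷ w))
longAscentsFrom _ (U ∷ w) = longAscentsFrom true w
longAscentsFrom _ (D ∷ w) = longAscentsFrom false w
longAscentsFrom _ (L ∷ w) = longAscentsFrom false w

longAscents : Word → ℕ
longAscents = longAscentsFrom false

-- Skew Dyck paths of semilength m: words of length 2m (since #U = #D + #L)
-- that are skew Dyck.
skewDyckPaths : ℕ → List Word
skewDyckPaths m = filterᵇ isSkewDyck (allWords (m + m))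

isBoxPath : ℕ → ℕ → Word → Bool
isBoxPath k n w = occurrences (boxFactor k) w ≡ᵇ n

boxPaths : ℕ → ℕ → List Word
boxPaths k n = filterᵇ (isBoxPath k n) (skewDyckPaths ((k + 2) * n ∸ 1))

numBoxPathsLongAsc : ℕ → ℕ → ℕ → ℕ
numBoxPathsLongAsc k n j = length (filterᵇ (λ w → longAscents w ≡ᵇ j) (boxPaths k n))

-- A k-box path of size n has (k + 2)n − 1 down steps, k + 1 in each of its n factors U D^k L.
-- A factor cannot be followed by U, so consecutive factors are separated by at least one more
-- down step, and the count leaves room for exactly one.  Hence the path is
-- U^x₁ (U D^k L) D U^x₂ (U D^k L) D … U^xₙ (U D^k L) with x₁ + ⋯ + xₙ = (k + 1)n − 1, its long
-- ascents correspond to the nonzero xᵢ, and it stays above the axis iff x₁ + ⋯ + xᵢ ≥ (k + 1)i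
-- for all i < n.  By the cycle lemma exactly one of the n rotations of a composition of
-- (k + 1)n − 1 into n parts satisfies this ballot condition, and rotation preserves the number
-- of nonzero parts.  So n times the count is the number of such compositions with j nonzero
-- parts, C(n, j) C((k + 1)n − 2, j − 1), and absorption j C(n, j) = n C(n − 1, j − 1) finishes.

module Submission where

open import Defs
open import Data.Nat using (ℕ; _+_; _*_; _∸_; _≤_)
open import Data.Nat.Combinatorics using (_C_)
open import Relation.Binary.PropositionalEquality using (_≡_)

open import Data.Bool using (Bool; true; false; _∧_; if_then_else_)
open import Data.Bool.Properties using (T-≡; ∧-conicalˡ; ∧-conicalʳ; ∧-zeroʳ)
open import Data.Empty using (⊥-elim)
open import Data.List using (List; []; _∷_; length; _++_; take; drop; replicate; filterᵇ; concatMap)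
open import Data.List.Properties
  using (≡-dec; length-++; length-drop; take++drop≡id; take-take; take-[]; ∷-injectiveʳ; ++-cancelˡ)
open import Data.Nat
open import Data.Nat.Combinatorics using (nCk+nC[k+1]≡[n+1]C[k+1]; nC1≡n)
open import Data.Nat.ListAction using (sum)
open import Data.Nat.ListAction.Properties using (sum-++)
open import Data.Nat.Properties
open import Data.Nat.Tactic.RingSolver using (solve-∀)
open import Algebra.Properties.CommutativeSemigroup +-commutativeSemigroup using (interchange; xy∙z≈y∙xz)
open import Data.Product using (∃; ∃₂; _×_; _,_; proj₁; proj₂)
open import Data.Sum using (inj₁; inj₂)
open import Function using (_∘_; Equivalence)
open import Relation.Binary.PropositionalEquality
open import Relation.Binary.Definitions using (DecidableEquality; tri<; tri≈; tri>)
open import Relation.Nullary using (does; yes; no)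

𝟙 : Bool → ℕ
𝟙 b = if b then 1 else 0

𝟙-∧ : ∀ a b → 𝟙 (a ∧ b) ≡ 𝟙 a * 𝟙 b
𝟙-∧ true b = sym (+-identityʳ (𝟙 b))
𝟙-∧ false b = refl

-- Finite sums

sumSplits : ℕ → (ℕ → ℕ → ℕ) → ℕ
sumSplits zero f = f 0 0
sumSplits (suc M) f = f 0 (suc M) + sumSplits M (λ x y → f (suc x) y)

sumSplits-cong : ∀ M {f g : ℕ → ℕ → ℕ} → (∀ x y → x + y ≡ M → f x y ≡ g x y) →
                 sumSplits M f ≡ sumSplits M g
sumSplits-cong zero f≗g = f≗g 0 0 refl
sumSplits-cong (suc M) f≗g =
  cong₂ _+_ (f≗g 0 (suc M) refl) (sumSplits-cong M (λ x y e → f≗g (suc x) y (cong suc e)))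

sumSplits-zero : ∀ M → sumSplits M (λ _ _ → 0) ≡ 0
sumSplits-zero zero = refl
sumSplits-zero (suc M) = sumSplits-zero M

sumSplits-+ : ∀ M (f g : ℕ → ℕ → ℕ) →
              sumSplits M (λ x y → f x y + g x y) ≡ sumSplits M f + sumSplits M g
sumSplits-+ zero f g = refl
sumSplits-+ (suc M) f g =
  trans (cong (f 0 (suc M) + g 0 (suc M) +_) (sumSplits-+ M (λ x y → f (suc x) y) (λ x y → g (suc x) y)))
        (interchange (f 0 (suc M)) (g 0 (suc M)) _ _)

sumSplits-*ˡ : ∀ M c (f : ℕ → ℕ → ℕ) → sumSplits M (λ x y → c * f x y) ≡ c * sumSplits M f
sumSplits-*ˡ zero c f = refl
sumSplits-*ˡ (suc M) c f =
  trans (cong (c * f 0 (suc M) +_) (sumSplits-*ˡ M c (λ x y → f (suc x) y)))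
        (sym (*-distribˡ-+ c (f 0 (suc M)) _))

sumSplits-snoc : ∀ M (f : ℕ → ℕ → ℕ) →
                 sumSplits (suc M) f ≡ sumSplits M (λ x y → f x (suc y)) + f (suc M) 0
sumSplits-snoc zero f = refl
sumSplits-snoc (suc M) f =
  trans (cong (f 0 (suc (suc M)) +_) (sumSplits-snoc M (λ x y → f (suc x) y)))
        (sym (+-assoc (f 0 (suc (suc M))) _ _))

sumSplits-comm : ∀ M (f : ℕ → ℕ → ℕ) → sumSplits M f ≡ sumSplits M (λ x y → f y x)
sumSplits-comm zero f = refl
sumSplits-comm (suc M) f = begin
  f 0 (suc M) + sumSplits M (λ x y → f (suc x) y)   ≡⟨ cong (f 0 (suc M) +_) (sumSplits-comm M _) ⟩
  f 0 (suc M) + sumSplits M (λ x y → f (suc y) x)   ≡⟨ +-comm (f 0 (suc M)) _ ⟩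
  sumSplits M (λ x y → f (suc y) x) + f 0 (suc M)   ≡⟨ sumSplits-snoc M (λ x y → f y x) ⟨
  sumSplits (suc M) (λ x y → f y x)                 ∎
  where open ≡-Reasoning

sumSplits-assoc : ∀ M (g : ℕ → ℕ → ℕ → ℕ) →
  sumSplits M (λ x z → sumSplits z (λ y w → g x y w)) ≡ sumSplits M (λ z w → sumSplits z (λ x y → g x y w))
sumSplits-assoc zero g = refl
sumSplits-assoc (suc M) g =
  trans (cong (sumSplits (suc M) (λ y w → g 0 y w) +_) (sumSplits-assoc M (λ x y w → g (suc x) y w)))
        (sym (trans (sumSplits-cong (suc M) (λ z w _ → peel z w)) (sumSplits-+ (suc M) (λ z w → g 0 z w) rest)))
  where
  rest : ℕ → ℕ → ℕ
  rest zero w = 0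
  rest (suc z) w = sumSplits z (λ x y → g (suc x) y w)
  peel : ∀ z w → sumSplits z (λ x y → g x y w) ≡ g 0 z w + rest z w
  peel zero w = sym (+-identityʳ _)
  peel (suc z) w = refl

sumSplits-δ : ∀ x₀ y₀ (F : ℕ → ℕ) → sumSplits (x₀ + y₀) (λ x y → if x ≡ᵇ x₀ then F y else 0) ≡ F y₀
sumSplits-δ zero zero F = refl
sumSplits-δ zero (suc y₀) F = trans (cong (F (suc y₀) +_) (sumSplits-zero y₀)) (+-identityʳ _)
sumSplits-δ (suc x₀) y₀ F = sumSplits-δ x₀ y₀ F

sumComps : ℕ → ℕ → (List ℕ → ℕ) → ℕ
sumComps zero zero h = h []
sumComps zero (suc M) h = 0
sumComps (suc n) M h = sumSplits M (λ x y → sumComps n y (λ a → h (x ∷ a)))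

sumComps-cong : ∀ n M {f g : List ℕ → ℕ} → (∀ a → length a ≡ n → sum a ≡ M → f a ≡ g a) →
                sumComps n M f ≡ sumComps n M g
sumComps-cong zero zero f≗g = f≗g [] refl refl
sumComps-cong zero (suc M) f≗g = refl
sumComps-cong (suc n) M f≗g = sumSplits-cong M (λ x y x+y≡M →
  sumComps-cong n y (λ a ∣a∣≡n Σa≡y → f≗g (x ∷ a) (cong suc ∣a∣≡n) (trans (cong (x +_) Σa≡y) x+y≡M)))

sumComps-zero : ∀ n M → sumComps n M (λ _ → 0) ≡ 0
sumComps-zero zero zero = refl
sumComps-zero zero (suc M) = refl
sumComps-zero (suc n) M = trans (sumSplits-cong M (λ x y _ → sumComps-zero n y)) (sumSplits-zero M)

sumComps-+ : ∀ n M (f g : List ℕ → ℕ) → sumComps n M (λ a → f a + g a) ≡ sumComps n M f + sumComps n M g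
sumComps-+ zero zero f g = refl
sumComps-+ zero (suc M) f g = refl
sumComps-+ (suc n) M f g =
  trans (sumSplits-cong M (λ x y _ → sumComps-+ n y (λ a → f (x ∷ a)) (λ a → g (x ∷ a))))
        (sumSplits-+ M _ _)

sumComps-sumSplits : ∀ n M P (G : ℕ → ℕ → List ℕ → ℕ) →
  sumComps n M (λ a → sumSplits P (λ x y → G x y a)) ≡ sumSplits P (λ x y → sumComps n M (G x y))
sumComps-sumSplits n M zero G = refl
sumComps-sumSplits n M (suc P) G =
  trans (sumComps-+ n M (G 0 (suc P)) _)
        (cong (sumComps n M (G 0 (suc P)) +_) (sumComps-sumSplits n M P (λ x y → G (suc x) y)))

sumComps-comm : ∀ n M n′ M′ (F : List ℕ → List ℕ → ℕ) →
  sumComps n M (λ u → sumComps n′ M′ (F u)) ≡ sumComps n′ M′ (λ v → sumComps n M (λ u → F u v))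
sumComps-comm zero zero n′ M′ F = refl
sumComps-comm zero (suc M) n′ M′ F = sym (sumComps-zero n′ M′)
sumComps-comm (suc n) M n′ M′ F =
  trans (sumSplits-cong M (λ x y _ → sumComps-comm n y n′ M′ (λ u → F (x ∷ u))))
        (sym (sumComps-sumSplits n′ M′ M (λ x y v → sumComps n y (λ u → F (x ∷ u) v))))

sumComps-++ : ∀ n₁ n₂ M (h : List ℕ → ℕ) →
  sumComps (n₁ + n₂) M h ≡ sumSplits M (λ M₁ M₂ → sumComps n₁ M₁ (λ u → sumComps n₂ M₂ (λ v → h (u ++ v))))
sumComps-++ zero n₂ zero h = refl
sumComps-++ zero n₂ (suc M) h = sym (trans (cong (sumComps n₂ (suc M) h +_) (sumSplits-zero M)) (+-identityʳ _))
sumComps-++ (suc n₁) n₂ M h =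
  trans (sumSplits-cong M (λ x y _ → sumComps-++ n₁ n₂ y (λ a → h (x ∷ a))))
        (sumSplits-assoc M (λ x y w → sumComps n₁ y (λ u → sumComps n₂ w (λ v → h (x ∷ u ++ v)))))

rotate : ∀ {A : Set} → ℕ → List A → List A
rotate r a = drop r a ++ take r a

rotate-length-++ : ∀ {A : Set} (u v : List A) → rotate (length u) (u ++ v) ≡ v ++ u
rotate-length-++ u v = cong₂ _++_ (drop-length-++ u) (take-length-++ u)
  where
  drop-length-++ : ∀ u → drop (length u) (u ++ v) ≡ v
  drop-length-++ [] = refl
  drop-length-++ (x ∷ u) = drop-length-++ u
  take-length-++ : ∀ u → take (length u) (u ++ v) ≡ u
  take-length-++ [] = refl
  take-length-++ (x ∷ u) = cong (x ∷_) (take-length-++ u)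

rotate-invariant : ∀ {A : Set} (f : List A → ℕ) → (∀ u v → f (u ++ v) ≡ f u + f v) →
                   ∀ r a → f (rotate r a) ≡ f a
rotate-invariant f f-++ r a = begin
  f (drop r a ++ take r a)  ≡⟨ f-++ (drop r a) (take r a) ⟩
  f (drop r a) + f (take r a) ≡⟨ +-comm (f (drop r a)) _ ⟩
  f (take r a) + f (drop r a) ≡⟨ f-++ (take r a) (drop r a) ⟨
  f (take r a ++ drop r a)  ≡⟨ cong f (take++drop≡id r a) ⟩
  f a ∎
  where open ≡-Reasoning

sumComps-rotate : ∀ n r M (h : List ℕ → ℕ) → r ≤ n → sumComps n M (h ∘ rotate r) ≡ sumComps n M h
sumComps-rotate n r M h r≤n = begin
  sumComps n M (h ∘ rotate r)
    ≡⟨ cong (λ n → sumComps n M (h ∘ rotate r)) (m+[n∸m]≡n r≤n) ⟨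
  sumComps (r + q) M (h ∘ rotate r)
    ≡⟨ sumComps-++ r q M _ ⟩
  sumSplits M (λ M₁ M₂ → sumComps r M₁ (λ u → sumComps q M₂ (λ v → h (rotate r (u ++ v)))))
    ≡⟨ sumSplits-cong M (λ M₁ M₂ _ → sumComps-cong r M₁ (λ u ∣u∣≡r _ → sumComps-cong q M₂ (λ v _ _ →
         cong h (subst (λ r → rotate r (u ++ v) ≡ v ++ u) ∣u∣≡r (rotate-length-++ u v))))) ⟩
  sumSplits M (λ M₁ M₂ → sumComps r M₁ (λ u → sumComps q M₂ (λ v → h (v ++ u))))
    ≡⟨ sumSplits-cong M (λ M₁ M₂ _ → sumComps-comm r M₁ q M₂ (λ u v → h (v ++ u))) ⟩
  sumSplits M (λ M₁ M₂ → sumComps q M₂ (λ v → sumComps r M₁ (λ u → h (v ++ u))))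
    ≡⟨ sumSplits-comm M _ ⟩
  sumSplits M (λ M₂ M₁ → sumComps q M₂ (λ v → sumComps r M₁ (λ u → h (v ++ u))))
    ≡⟨ sumComps-++ q r M h ⟨
  sumComps (q + r) M h
    ≡⟨ cong (λ n → sumComps n M h) (m∸n+n≡m r≤n) ⟩
  sumComps n M h ∎
  where
  open ≡-Reasoning
  q = n ∸ r

_≟ₗ_ : DecidableEquality (List ℕ)
_≟ₗ_ = ≡-dec _≟_

sumComps-δ : ∀ a₀ → sumComps (length a₀) (sum a₀) (λ a → 𝟙 (does (a ≟ₗ a₀))) ≡ 1
sumComps-δ [] = refl
sumComps-δ (x₀ ∷ a₀) = begin
  sumSplits (x₀ + sum a₀) (λ x y → sumComps n y (λ a → 𝟙 ((x ≡ᵇ x₀) ∧ does (a ≟ₗ a₀))))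
    ≡⟨ sumSplits-cong (x₀ + sum a₀) (λ x y _ → split (x ≡ᵇ x₀) y) ⟩
  sumSplits (x₀ + sum a₀) (λ x y → if x ≡ᵇ x₀ then sumComps n y (λ a → 𝟙 (does (a ≟ₗ a₀))) else 0)
    ≡⟨ sumSplits-δ x₀ (sum a₀) _ ⟩
  sumComps n (sum a₀) (λ a → 𝟙 (does (a ≟ₗ a₀)))
    ≡⟨ sumComps-δ a₀ ⟩
  1 ∎
  where
  open ≡-Reasoning
  n = length a₀
  split : ∀ b y → sumComps n y (λ a → 𝟙 (b ∧ does (a ≟ₗ a₀))) ≡
                  (if b then sumComps n y (λ a → 𝟙 (does (a ≟ₗ a₀))) else 0)
  split true y = refl
  split false y = sumComps-zero n y

-- Compositions with a given number of nonzero parts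

nonzeros : List ℕ → ℕ
nonzeros [] = 0
nonzeros (zero ∷ a) = nonzeros a
nonzeros (suc _ ∷ a) = suc (nonzeros a)

nonzeros-++ : ∀ u v → nonzeros (u ++ v) ≡ nonzeros u + nonzeros v
nonzeros-++ [] v = refl
nonzeros-++ (zero ∷ u) v = nonzeros-++ u v
nonzeros-++ (suc _ ∷ u) v = cong suc (nonzeros-++ u v)

-- The number of compositions of M into j positive parts, split by whether the last part is 1.
positiveComps : ℕ → ℕ → ℕ
positiveComps zero zero = 1
positiveComps (suc M) zero = 0
positiveComps zero (suc j) = 0
positiveComps (suc M) (suc j) = positiveComps M (suc j) + positiveComps M j

positiveComps-suc : ∀ M j → positiveComps (suc M) (suc j) ≡ M C j
positiveComps-suc zero zero = refl
positiveComps-suc zero (suc j) = refl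
positiveComps-suc (suc M) zero = trans (+-identityʳ _) (positiveComps-suc M zero)
positiveComps-suc (suc M) (suc j) = begin
  positiveComps (suc M) (suc (suc j)) + positiveComps (suc M) (suc j)
    ≡⟨ cong₂ _+_ (positiveComps-suc M (suc j)) (positiveComps-suc M j) ⟩
  M C suc j + M C j ≡⟨ +-comm (M C suc j) (M C j) ⟩
  M C j + M C suc j ≡⟨ nCk+nC[k+1]≡[n+1]C[k+1] M j ⟩
  suc M C suc j ∎
  where open ≡-Reasoning

sumSplits-positiveComps : ∀ M j → sumSplits M (λ _ y → positiveComps y j) ≡ positiveComps (suc M) (suc j)
sumSplits-positiveComps zero j = refl
sumSplits-positiveComps (suc M) j =
  trans (cong (positiveComps (suc M) j +_) (sumSplits-positiveComps M j))
        (+-comm (positiveComps (suc M) j) _)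

sumComps-nonzeros : ∀ n M j → sumComps n M (λ a → 𝟙 (nonzeros a ≡ᵇ j)) ≡ (n C j) * positiveComps M j
sumComps-nonzeros zero zero zero = refl
sumComps-nonzeros zero zero (suc j) = refl
sumComps-nonzeros zero (suc M) zero = refl
sumComps-nonzeros zero (suc M) (suc j) = refl
sumComps-nonzeros (suc n) M zero =
  trans (sumSplits-cong M (λ x y _ → split x y)) (trans (sumSplits-δ 0 M _) (sumComps-nonzeros n M zero))
  where
  split : ∀ x y → sumComps n y (λ a → 𝟙 (nonzeros (x ∷ a) ≡ᵇ 0)) ≡
                  (if x ≡ᵇ 0 then sumComps n y (λ a → 𝟙 (nonzeros a ≡ᵇ 0)) else 0)
  split zero y = refl
  split (suc x) y = sumComps-zero n y
sumComps-nonzeros (suc n) zero (suc j) =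
  trans (sumComps-nonzeros n zero (suc j)) (trans (*-zeroʳ (n C suc j)) (sym (*-zeroʳ (suc n C suc j))))
sumComps-nonzeros (suc n) (suc M) (suc j) = begin
  sumComps n (suc M) (λ a → 𝟙 (nonzeros a ≡ᵇ suc j)) + sumSplits M (λ _ y → sumComps n y (λ a → 𝟙 (nonzeros a ≡ᵇ j)))
    ≡⟨ cong₂ _+_ (sumComps-nonzeros n (suc M) (suc j)) (sumSplits-cong M (λ _ y _ → sumComps-nonzeros n y j)) ⟩
  (n C suc j) * P + sumSplits M (λ _ y → (n C j) * positiveComps y j)
    ≡⟨ cong ((n C suc j) * P +_) (trans (sumSplits-*ˡ M (n C j) _) (cong ((n C j) *_) (sumSplits-positiveComps M j))) ⟩
  (n C suc j) * P + (n C j) * P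
    ≡⟨ *-distribʳ-+ P (n C suc j) (n C j) ⟨
  (n C suc j + n C j) * P
    ≡⟨ cong (_* P) (trans (+-comm (n C suc j) (n C j)) (nCk+nC[k+1]≡[n+1]C[k+1] n j)) ⟩
  (suc n C suc j) * P ∎
  where
  open ≡-Reasoning
  P = positiveComps (suc M) (suc j)

[1+k]*[1+n]C[1+k]≡[1+n]*nCk : ∀ n k → suc k * (suc n C suc k) ≡ suc n * (n C k)
[1+k]*[1+n]C[1+k]≡[1+n]*nCk zero zero = refl
[1+k]*[1+n]C[1+k]≡[1+n]*nCk zero (suc k) = *-zeroʳ (suc (suc k))
[1+k]*[1+n]C[1+k]≡[1+n]*nCk (suc n) zero =
  trans (+-identityʳ _) (trans (nC1≡n (suc (suc n))) (sym (*-identityʳ (suc (suc n)))))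
[1+k]*[1+n]C[1+k]≡[1+n]*nCk (suc n) (suc k) = begin
  (2 + k) * (suc (suc n) C suc (suc k))
    ≡⟨ cong ((2 + k) *_) (nCk+nC[k+1]≡[n+1]C[k+1] (suc n) (suc k)) ⟨
  (2 + k) * (X′ + Y′)
    ≡⟨ split-factor k X′ Y′ ⟩
  ((1 + k) * X′ + X′) + (2 + k) * Y′
    ≡⟨ cong₂ (λ a b → (a + X′) + b) ([1+k]*[1+n]C[1+k]≡[1+n]*nCk n k) ([1+k]*[1+n]C[1+k]≡[1+n]*nCk n (suc k)) ⟩
  ((1 + n) * X + X′) + (1 + n) * Y
    ≡⟨ cong (λ b → ((1 + n) * X + b) + (1 + n) * Y) (nCk+nC[k+1]≡[n+1]C[k+1] n k) ⟨
  ((1 + n) * X + (X + Y)) + (1 + n) * Y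
    ≡⟨ merge-factor n X Y ⟩
  (2 + n) * (X + Y)
    ≡⟨ cong ((2 + n) *_) (nCk+nC[k+1]≡[n+1]C[k+1] n k) ⟩
  (2 + n) * X′ ∎
  where
  open ≡-Reasoning
  X = n C k
  Y = n C suc k
  X′ = suc n C suc k
  Y′ = suc n C suc (suc k)
  split-factor : ∀ k Z W → (2 + k) * (Z + W) ≡ ((1 + k) * Z + Z) + (2 + k) * W
  split-factor = solve-∀
  merge-factor : ∀ n X Y → ((1 + n) * X + (X + Y)) + (1 + n) * Y ≡ (2 + n) * (X + Y)
  merge-factor = solve-∀

sumBelow : ℕ → (ℕ → ℕ) → ℕ
sumBelow zero f = 0
sumBelow (suc n) f = sumBelow n f + f n

sumBelow-cong : ∀ n {f g : ℕ → ℕ} → (∀ t → t < n → f t ≡ g t) → sumBelow n f ≡ sumBelow n g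
sumBelow-cong zero f≗g = refl
sumBelow-cong (suc n) f≗g = cong₂ _+_ (sumBelow-cong n (λ t t<n → f≗g t (m<n⇒m<1+n t<n))) (f≗g n ≤-refl)

sumBelow-const : ∀ n x → sumBelow n (λ _ → x) ≡ n * x
sumBelow-const zero x = refl
sumBelow-const (suc n) x = trans (cong (_+ x) (sumBelow-const n x)) (+-comm (n * x) x)

sumBelow-*ʳ : ∀ n (f : ℕ → ℕ) x → sumBelow n (λ t → f t * x) ≡ sumBelow n f * x
sumBelow-*ʳ zero f x = refl
sumBelow-*ʳ (suc n) f x =
  trans (cong (_+ f n * x) (sumBelow-*ʳ n f x)) (sym (*-distribʳ-+ x (sumBelow n f) (f n)))

sumBelow-sumComps : ∀ N n M (F : ℕ → List ℕ → ℕ) →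
                    sumBelow N (λ t → sumComps n M (F t)) ≡ sumComps n M (λ a → sumBelow N (λ t → F t a))
sumBelow-sumComps zero n M F = sym (sumComps-zero n M)
sumBelow-sumComps (suc N) n M F =
  trans (cong (_+ sumComps n M (F N)) (sumBelow-sumComps N n M F)) (sym (sumComps-+ n M _ (F N)))

sumBelow-zero : ∀ n (f : ℕ → ℕ) → (∀ t → t < n → f t ≡ 0) → sumBelow n f ≡ 0
sumBelow-zero zero f f≡0 = refl
sumBelow-zero (suc n) f f≡0 = cong₂ _+_ (sumBelow-zero n f (λ t t<n → f≡0 t (m<n⇒m<1+n t<n))) (f≡0 n ≤-refl)

sumBelow-δ : ∀ n (f : ℕ → ℕ) t₀ → t₀ < n → f t₀ ≡ 1 → (∀ t → t < n → t ≢ t₀ → f t ≡ 0) →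
             sumBelow n f ≡ 1
sumBelow-δ (suc n) f t₀ t₀<1+n f[t₀]≡1 f≡0 with t₀ ≟ n
... | yes refl =
  cong₂ _+_ (sumBelow-zero n f (λ t t<n → f≡0 t (m<n⇒m<1+n t<n) (<⇒≢ t<n))) f[t₀]≡1
... | no t₀≢n =
  cong₂ _+_ (sumBelow-δ n f t₀ (≤∧≢⇒< (≤-pred t₀<1+n) t₀≢n) f[t₀]≡1 (λ t t<n → f≡0 t (m<n⇒m<1+n t<n)))
            (f≡0 n ≤-refl (t₀≢n ∘ sym))

-- The cycle lemma

LeftmostMinimum : (ℕ → ℕ) → ℕ → ℕ → Set
LeftmostMinimum K n t = (∀ s → t < s → s < n → K t ≤ K s) × (∀ s → s < t → K t < K s)

leftmostArgmin : ∀ (K : ℕ → ℕ) n →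
  ∃ λ t → t < suc n × (∀ s → s < suc n → K t ≤ K s) × (∀ s → s < t → K t < K s)
leftmostArgmin K zero = 0 , z<s , (λ { s (s≤s z≤n) → ≤-refl }) , (λ s ())
leftmostArgmin K (suc n) with leftmostArgmin K n
... | t , t<1+n , K[t]≤ , K[t]< with K (suc n) <? K t
...   | yes K[n+1]<K[t] = suc n , ≤-refl , minimal , (λ s s<n+1 → <-≤-trans K[n+1]<K[t] (K[t]≤ s s<n+1))
  where
  minimal : ∀ s → s < suc (suc n) → K (suc n) ≤ K s
  minimal s s<n+2 with m<1+n⇒m<n∨m≡n s<n+2
  ... | inj₁ s<n+1 = <⇒≤ (<-≤-trans K[n+1]<K[t] (K[t]≤ s s<n+1))
  ... | inj₂ refl = ≤-refl
...   | no K[n+1]≮K[t] = t , m<n⇒m<1+n t<1+n , minimal , K[t]<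
  where
  minimal : ∀ s → s < suc (suc n) → K t ≤ K s
  minimal s s<n+2 with m<1+n⇒m<n∨m≡n s<n+2
  ... | inj₁ s<n+1 = K[t]≤ s s<n+1
  ... | inj₂ refl = ≮⇒≥ K[n+1]≮K[t]

sumBelow-leftmostMinimum : ∀ (K : ℕ → ℕ) n (good : ℕ → Bool) →
  (∀ t → t < n → good t ≡ true → LeftmostMinimum K n t) →
  (∀ t → t < n → LeftmostMinimum K n t → good t ≡ true) →
  1 ≤ n → sumBelow n (𝟙 ∘ good) ≡ 1
sumBelow-leftmostMinimum K (suc n) good sound complete _ with leftmostArgmin K n
... | t₀ , t₀<n , K[t₀]≤ , K[t₀]< =
  sumBelow-δ (suc n) (𝟙 ∘ good) t₀ t₀<n (cong 𝟙 (complete t₀ t₀<n ((λ s _ → K[t₀]≤ s) , K[t₀]<))) unique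
  where
  unique : ∀ t → t < suc n → t ≢ t₀ → 𝟙 (good t) ≡ 0
  unique t t<n t≢t₀ with good t in good[t]
  ... | false = refl
  ... | true with <-cmp t t₀ | sound t t<n good[t]
  ...   | tri< t<t₀ _ _ | (K[t]≤ , _) = ⊥-elim (<⇒≱ (K[t₀]< t t<t₀) (K[t]≤ t₀ t<t₀ t₀<n))
  ...   | tri≈ _ t≡t₀ _ | _ = ⊥-elim (t≢t₀ t≡t₀)
  ...   | tri> _ _ t₀<t | (_ , K[t]<) = ⊥-elim (<⇒≱ (K[t]< t₀ t₀<t) (K[t₀]≤ t t<n))

take-++-≤ : ∀ {A : Set} (u v : List A) i → i ≤ length u → take i (u ++ v) ≡ take i u
take-++-≤ u v zero _ = refl
take-++-≤ [] v (suc i) ()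
take-++-≤ (x ∷ u) v (suc i) (s≤s i≤∣u∣) = cong (x ∷_) (take-++-≤ u v i i≤∣u∣)

take-length-+-++ : ∀ {A : Set} (u v : List A) i → take (length u + i) (u ++ v) ≡ u ++ take i v
take-length-+-++ [] v i = refl
take-length-+-++ (x ∷ u) v i = cong (x ∷_) (take-length-+-++ u v i)

take-take-≤ : ∀ {A : Set} {s t} (a : List A) → s ≤ t → take s (take t a) ≡ take s a
take-take-≤ {s = s} {t} a s≤t = trans (take-take s t a) (cong (λ m → take m a) (m≤n⇒m⊓n≡m s≤t))

sum-take-drop : ∀ t a → sum (take t a) + sum (drop t a) ≡ sum a
sum-take-drop t a = trans (sym (sum-++ (take t a) (drop t a))) (cong sum (take++drop≡id t a))

sum-take-+ : ∀ t i a → sum (take t a) + sum (take i (drop t a)) ≡ sum (take (t + i) a)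
sum-take-+ zero i a = refl
sum-take-+ (suc t) i [] = cong sum (take-[] i)
sum-take-+ (suc t) i (x ∷ a) = trans (+-assoc x _ _) (cong (x +_) (sum-take-+ t i a))

≡true⇒≤ : ∀ {m n} → (m ≤ᵇ n) ≡ true → m ≤ n
≡true⇒≤ {m} {n} e = ≤ᵇ⇒≤ m n (Equivalence.from T-≡ e)

≤⇒≡true : ∀ {m n} → m ≤ n → (m ≤ᵇ n) ≡ true
≤⇒≡true m≤n = Equivalence.to T-≡ (≤⇒≤ᵇ m≤n)

≡true⇒≡ : ∀ {m n} → (m ≡ᵇ n) ≡ true → m ≡ n
≡true⇒≡ {m} {n} e = ≡ᵇ⇒≡ m n (Equivalence.from T-≡ e)

≡⇒≡true : ∀ {m n} → m ≡ n → (m ≡ᵇ n) ≡ true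
≡⇒≡true {m} {n} m≡n = Equivalence.to T-≡ (≡⇒≡ᵇ m n m≡n)

≤-shift : ∀ {x x′ y y′} r p → x + r ≡ y + p → x′ + r ≡ y′ + p → x ≤ x′ → y ≤ y′
≤-shift {x′ = x′} r p e e′ x≤x′ = +-cancelʳ-≤ p _ _ (subst₂ _≤_ e e′ (+-monoˡ-≤ r x≤x′))

module Ballot (k : ℕ) where

  -- Reading the parts of b as ascents, each followed by a descent of k + 1, from height h: the
  -- path must stay nonnegative between parts and end at height 0 (cf. heightOK-encode below).
  isBallot : ℕ → List ℕ → Bool
  isBallot h [] = false
  isBallot h (x ∷ []) = h + x ≡ᵇ k
  isBallot h (x ∷ y ∷ r) = (suc k ≤ᵇ h + x) ∧ isBallot (h + x ∸ suc k) (y ∷ r)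

  BallotFrom : ℕ → List ℕ → Set
  BallotFrom h b = ∀ i → 1 ≤ i → i < length b → suc k * i ≤ h + sum (take i b)

  private
    descend : ∀ h x z → suc k ≤ h + x → h + (x + z) ≡ suc k + ((h + x ∸ suc k) + z)
    descend h x z k<h+x = begin
      h + (x + z)                        ≡⟨ +-assoc h x z ⟨
      (h + x) + z                        ≡⟨ cong (_+ z) (m+[n∸m]≡n k<h+x) ⟨
      (suc k + (h + x ∸ suc k)) + z      ≡⟨ +-assoc (suc k) _ z ⟩
      suc k + ((h + x ∸ suc k) + z)      ∎
      where open ≡-Reasoning

    descend-total : ∀ h x y r → suc k ≤ h + x →
                    h + sum (x ∷ y ∷ r) + 1 ≡ suc k + ((h + x ∸ suc k) + sum (y ∷ r) + 1)
    descend-total h x y r k<h+x =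
      trans (cong (_+ 1) (descend h x (sum (y ∷ r)) k<h+x)) (+-assoc (suc k) _ 1)

  isBallot-sum : ∀ h b → isBallot h b ≡ true → h + sum b + 1 ≡ suc k * length b
  isBallot-sum h (x ∷ []) e = begin
    h + (x + 0) + 1 ≡⟨ cong (λ z → h + z + 1) (+-identityʳ x) ⟩
    h + x + 1       ≡⟨ cong (_+ 1) (≡true⇒≡ e) ⟩
    k + 1           ≡⟨ +-comm k 1 ⟩
    suc k           ≡⟨ *-identityʳ (suc k) ⟨
    suc k * 1       ∎
    where open ≡-Reasoning
  isBallot-sum h (x ∷ y ∷ r) e = begin
    h + sum (x ∷ y ∷ r) + 1                       ≡⟨ descend-total h x y r k<h+x ⟩
    suc k + ((h + x ∸ suc k) + sum (y ∷ r) + 1)   ≡⟨ cong (suc k +_) (isBallot-sum _ (y ∷ r) (∧-conicalʳ _ _ e)) ⟩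
    suc k + suc k * length (y ∷ r)                ≡⟨ *-suc (suc k) _ ⟨
    suc k * length (x ∷ y ∷ r)                    ∎
    where
    open ≡-Reasoning
    k<h+x = ≡true⇒≤ (∧-conicalˡ _ _ e)

  isBallot-sound : ∀ h b → isBallot h b ≡ true → BallotFrom h b
  isBallot-sound h (x ∷ []) e (suc i) _ (s≤s ())
  isBallot-sound h (x ∷ y ∷ r) e 1 _ _ =
    subst₂ _≤_ (sym (*-identityʳ (suc k))) (cong (h +_) (sym (+-identityʳ x))) (≡true⇒≤ (∧-conicalˡ _ _ e))
  isBallot-sound h (x ∷ y ∷ r) e (suc (suc i)) _ (s≤s i<∣y∷r∣) = begin
    suc k * suc (suc i)                                      ≡⟨ *-suc (suc k) (suc i) ⟩
    suc k + suc k * suc i                                    ≤⟨ +-monoʳ-≤ (suc k) tail ⟩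
    suc k + ((h + x ∸ suc k) + sum (take (suc i) (y ∷ r)))   ≡⟨ descend h x _ k<h+x ⟨
    h + sum (take (suc (suc i)) (x ∷ y ∷ r))                 ∎
    where
    open ≤-Reasoning
    k<h+x = ≡true⇒≤ (∧-conicalˡ _ _ e)
    tail = isBallot-sound _ (y ∷ r) (∧-conicalʳ _ _ e) (suc i) (s≤s z≤n) i<∣y∷r∣

  isBallot-complete : ∀ h b → h + sum b + 1 ≡ suc k * length b → BallotFrom h b → isBallot h b ≡ true
  isBallot-complete h [] total _ = ⊥-elim (1+n≢0 (trans (+-comm 1 (h + 0)) (trans total (*-zeroʳ (suc k)))))
  isBallot-complete h (x ∷ []) total _ = ≡⇒≡true (suc-injective (begin
    suc (h + x)     ≡⟨ +-comm 1 (h + x) ⟩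
    h + x + 1       ≡⟨ cong (λ z → h + z + 1) (+-identityʳ x) ⟨
    h + (x + 0) + 1 ≡⟨ total ⟩
    suc k * 1       ≡⟨ *-identityʳ (suc k) ⟩
    suc k           ∎))
    where open ≡-Reasoning
  isBallot-complete h (x ∷ y ∷ r) total ballot =
    cong₂ _∧_ (≤⇒≡true k<h+x) (isBallot-complete _ (y ∷ r) total′ ballot′)
    where
    k<h+x : suc k ≤ h + x
    k<h+x = subst₂ _≤_ (*-identityʳ (suc k)) (cong (h +_) (+-identityʳ x)) (ballot 1 ≤-refl (s≤s (s≤s z≤n)))
    total′ : (h + x ∸ suc k) + sum (y ∷ r) + 1 ≡ suc k * length (y ∷ r)
    total′ = +-cancelˡ-≡ (suc k) _ _
      (trans (sym (descend-total h x y r k<h+x)) (trans total (*-suc (suc k) (length (y ∷ r)))))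
    ballot′ : BallotFrom (h + x ∸ suc k) (y ∷ r)
    ballot′ i 1≤i i<∣y∷r∣ = +-cancelˡ-≤ (suc k) _ _
      (subst₂ _≤_ (*-suc (suc k) i) (descend h x _ k<h+x) (ballot (suc i) (s≤s z≤n) (s≤s i<∣y∷r∣)))

  module _ (a : List ℕ) (n : ℕ) (∣a∣≡n : length a ≡ n) (Σa+1≡cn : sum a + 1 ≡ suc k * n) where

    private
      c = suc k

      P : ℕ → ℕ
      P s = sum (take s a)

      -- The height P s − c s of the path after s parts, shifted by c n to stay in ℕ.
      K : ℕ → ℕ
      K s = P s + c * (n ∸ s)

      K-+ : ∀ s → s ≤ n → K s + c * s ≡ P s + c * n
      K-+ s s≤n = trans (+-assoc (P s) _ _)
        (cong (P s +_) (trans (sym (*-distribˡ-+ c (n ∸ s) s)) (cong (c *_) (m∸n+n≡m s≤n))))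

      module Rotation (t : ℕ) (t<n : t < n) where
        u = drop t a
        b = rotate t a

        ∣u∣≡n∸t : length u ≡ n ∸ t
        ∣u∣≡n∸t = trans (length-drop t a) (cong (_∸ t) ∣a∣≡n)

        ∣b∣≡n : length b ≡ n
        ∣b∣≡n = trans (rotate-invariant length (λ u v → length-++ u) t a) ∣a∣≡n

        -- Prefixes of b inside u compare K t with a later K s, ...
        K-later : ∀ i → i ≤ n ∸ t → K t + c * (t + i) ≡ c * i + (P t + c * n)
                                  × K (t + i) + c * (t + i) ≡ sum (take i b) + (P t + c * n)
        K-later i i≤n∸t = at-t , at-t+i
          where
          open ≡-Reasoning
          at-t = begin
            K t + c * (t + i)       ≡⟨ cong (K t +_) (*-distribˡ-+ c t i) ⟩
            K t + (c * t + c * i)   ≡⟨ +-assoc (K t) _ _ ⟨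
            (K t + c * t) + c * i   ≡⟨ cong (_+ c * i) (K-+ t (<⇒≤ t<n)) ⟩
            (P t + c * n) + c * i   ≡⟨ +-comm (P t + c * n) (c * i) ⟩
            c * i + (P t + c * n)   ∎
          t+i≤n = subst (t + i ≤_) (m+[n∸m]≡n (<⇒≤ t<n)) (+-monoʳ-≤ t i≤n∸t)
          i≤∣u∣ = subst (i ≤_) (sym ∣u∣≡n∸t) i≤n∸t
          at-t+i = begin
            K (t + i) + c * (t + i)        ≡⟨ K-+ (t + i) t+i≤n ⟩
            P (t + i) + c * n              ≡⟨ cong (_+ c * n) (sum-take-+ t i a) ⟨
            (P t + sum (take i u)) + c * n ≡⟨ xy∙z≈y∙xz (P t) _ (c * n) ⟩
            sum (take i u) + (P t + c * n) ≡⟨ cong (λ l → sum l + (P t + c * n)) (take-++-≤ u _ i i≤∣u∣) ⟨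
            sum (take i b) + (P t + c * n) ∎

        -- ... and prefixes reaching into take t a compare it with an earlier K s.
        K-earlier : ∀ s → s ≤ t → suc (K t) + c * s ≡ suc (c * ((n ∸ t) + s)) + P t
                                × K s + c * s ≡ suc (sum (take ((n ∸ t) + s) b)) + P t
        K-earlier s s≤t = at-t , at-s
          where
          open ≡-Reasoning
          at-t = cong suc (begin
            (P t + c * (n ∸ t)) + c * s  ≡⟨ +-assoc (P t) _ _ ⟩
            P t + (c * (n ∸ t) + c * s)  ≡⟨ cong (P t +_) (*-distribˡ-+ c (n ∸ t) s) ⟨
            P t + c * ((n ∸ t) + s)      ≡⟨ +-comm (P t) _ ⟩
            c * ((n ∸ t) + s) + P t      ∎)
          prefix : sum (take ((n ∸ t) + s) b) ≡ sum u + P s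
          prefix = begin
            sum (take ((n ∸ t) + s) b)          ≡⟨ cong (λ m → sum (take (m + s) b)) ∣u∣≡n∸t ⟨
            sum (take (length u + s) b)         ≡⟨ cong sum (take-length-+-++ u (take t a) s) ⟩
            sum (u ++ take s (take t a))        ≡⟨ sum-++ u _ ⟩
            sum u + sum (take s (take t a))     ≡⟨ cong (λ l → sum u + sum l) (take-take-≤ a s≤t) ⟩
            sum u + P s                         ∎
          at-s = begin
            K s + c * s                        ≡⟨ K-+ s (≤-trans s≤t (<⇒≤ t<n)) ⟩
            P s + c * n                        ≡⟨ cong (P s +_) Σa+1≡cn ⟨
            P s + (sum a + 1)                  ≡⟨ cong (λ z → P s + (z + 1)) (sum-take-drop t a) ⟨
            P s + ((P t + sum u) + 1)          ≡⟨ rearrange (P s) (P t) (sum u) ⟩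
            suc (sum u + P s) + P t            ≡⟨ cong (λ z → suc z + P t) prefix ⟨
            suc (sum (take ((n ∸ t) + s) b)) + P t ∎
            where
            rearrange : ∀ p q w → p + ((q + w) + 1) ≡ suc (w + p) + q
            rearrange = solve-∀

        ballot⇒leftmostMinimum : BallotFrom 0 b → LeftmostMinimum K n t
        ballot⇒leftmostMinimum ballot = later , earlier
          where
          later : ∀ s → t < s → s < n → K t ≤ K s
          later s t<s s<n = subst (λ s → K t ≤ K s) (m+[n∸m]≡n (<⇒≤ t<s))
            (≤-shift _ _ (sym (proj₁ (K-later i i≤n∸t))) (sym (proj₂ (K-later i i≤n∸t)))
              (ballot i (m<n⇒0<n∸m t<s) (subst (i <_) (sym ∣b∣≡n) (≤-<-trans (m∸n≤m s t) s<n))))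
            where
            i = s ∸ t
            i≤n∸t = ∸-monoˡ-≤ t (<⇒≤ s<n)
          earlier : ∀ s → s < t → K t < K s
          earlier s s<t =
            ≤-shift _ _ (sym (proj₁ (K-earlier s (<⇒≤ s<t)))) (sym (proj₂ (K-earlier s (<⇒≤ s<t))))
              (s≤s (ballot ((n ∸ t) + s) (≤-trans (m<n⇒0<n∸m t<n) (m≤m+n (n ∸ t) s))
                (subst ((n ∸ t) + s <_) (trans (m∸n+n≡m (<⇒≤ t<n)) (sym ∣b∣≡n)) (+-monoʳ-< (n ∸ t) s<t))))

        leftmostMinimum⇒ballot : LeftmostMinimum K n t → BallotFrom 0 b
        leftmostMinimum⇒ballot (later , earlier) i 1≤i i<∣b∣ with i <? n ∸ t
        ... | yes i<n∸t =
          ≤-shift _ _ (proj₁ (K-later i (<⇒≤ i<n∸t))) (proj₂ (K-later i (<⇒≤ i<n∸t)))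
            (later (t + i) (m<m+n t 1≤i)
              (subst (_< n) (+-comm i t) (m≤o∸n⇒m+n≤o (suc i) (<⇒≤ t<n) i<n∸t)))
        ... | no i≮n∸t = subst (λ i → c * i ≤ sum (take i b)) n∸t+s≡i
          (≤-pred (≤-shift _ _ (proj₁ (K-earlier s (<⇒≤ s<t))) (proj₂ (K-earlier s (<⇒≤ s<t))) (earlier s s<t)))
          where
          s = i ∸ (n ∸ t)
          n∸t+s≡i : (n ∸ t) + s ≡ i
          n∸t+s≡i = m+[n∸m]≡n (≮⇒≥ i≮n∸t)
          s<t : s < t
          s<t = +-cancelˡ-< (n ∸ t) s t
            (subst₂ _<_ (sym n∸t+s≡i) (trans ∣b∣≡n (sym (m∸n+n≡m (<⇒≤ t<n)))) i<∣b∣)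

    cycleLemma : 1 ≤ n → sumBelow n (λ t → 𝟙 (isBallot 0 (rotate t a))) ≡ 1
    cycleLemma 1≤n = sumBelow-leftmostMinimum K n (λ t → isBallot 0 (rotate t a)) sound complete 1≤n
      where
      sound : ∀ t → t < n → isBallot 0 (rotate t a) ≡ true → LeftmostMinimum K n t
      sound t t<n e = Rotation.ballot⇒leftmostMinimum t t<n (isBallot-sound 0 (rotate t a) e)
      complete : ∀ t → t < n → LeftmostMinimum K n t → isBallot 0 (rotate t a) ≡ true
      complete t t<n lm = isBallot-complete 0 (rotate t a) total (Rotation.leftmostMinimum⇒ballot t t<n lm)
        where
        total : sum (rotate t a) + 1 ≡ suc k * length (rotate t a)
        total = trans (cong (_+ 1) (rotate-invariant sum sum-++ t a))
                      (trans Σa+1≡cn (cong (suc k *_) (sym (Rotation.∣b∣≡n t t<n))))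

  n*ballots≡compositions : ∀ n M j → 1 ≤ n → M + 1 ≡ suc k * n →
    n * sumComps n M (λ a → 𝟙 (isBallot 0 a ∧ (nonzeros a ≡ᵇ j))) ≡ sumComps n M (λ a → 𝟙 (nonzeros a ≡ᵇ j))
  n*ballots≡compositions n M j 1≤n M+1≡cn = begin
    n * sumComps n M f
      ≡⟨ sumBelow-const n _ ⟨
    sumBelow n (λ _ → sumComps n M f)
      ≡⟨ sumBelow-cong n (λ r r<n → sumComps-rotate n r M f (<⇒≤ r<n)) ⟨
    sumBelow n (λ r → sumComps n M (f ∘ rotate r))
      ≡⟨ sumBelow-sumComps n n M (λ r → f ∘ rotate r) ⟩
    sumComps n M (λ a → sumBelow n (λ r → f (rotate r a)))
      ≡⟨ sumComps-cong n M one-rotation ⟩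
    sumComps n M (λ a → 𝟙 (nonzeros a ≡ᵇ j)) ∎
    where
    open ≡-Reasoning
    f : List ℕ → ℕ
    f a = 𝟙 (isBallot 0 a ∧ (nonzeros a ≡ᵇ j))
    one-rotation : ∀ a → length a ≡ n → sum a ≡ M → sumBelow n (λ r → f (rotate r a)) ≡ 𝟙 (nonzeros a ≡ᵇ j)
    one-rotation a ∣a∣≡n Σa≡M = begin
      sumBelow n (λ r → f (rotate r a))
        ≡⟨ sumBelow-cong n (λ r _ → trans (𝟙-∧ (isBallot 0 (rotate r a)) _)
             (cong (λ z → 𝟙 (isBallot 0 (rotate r a)) * 𝟙 (z ≡ᵇ j)) (rotate-invariant nonzeros nonzeros-++ r a))) ⟩
      sumBelow n (λ r → 𝟙 (isBallot 0 (rotate r a)) * 𝟙 (nonzeros a ≡ᵇ j))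
        ≡⟨ sumBelow-*ʳ n _ _ ⟩
      sumBelow n (λ r → 𝟙 (isBallot 0 (rotate r a))) * 𝟙 (nonzeros a ≡ᵇ j)
        ≡⟨ cong (_* 𝟙 (nonzeros a ≡ᵇ j)) (cycleLemma a n ∣a∣≡n (trans (cong (_+ 1) Σa≡M) M+1≡cn) 1≤n) ⟩
      1 * 𝟙 (nonzeros a ≡ᵇ j)
        ≡⟨ *-identityˡ _ ⟩
      𝟙 (nonzeros a ≡ᵇ j) ∎

-- Counting words

_≟ₛ_ : DecidableEquality Step
U ≟ₛ U = yes refl
U ≟ₛ D = no (λ ())
U ≟ₛ L = no (λ ())
D ≟ₛ U = no (λ ())
D ≟ₛ D = yes refl
D ≟ₛ L = no (λ ())
L ≟ₛ U = no (λ ())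
L ≟ₛ D = no (λ ())
L ≟ₛ L = yes refl

_≟ʷ_ : DecidableEquality Word
_≟ʷ_ = ≡-dec _≟ₛ_

sumWords : ℕ → (Word → ℕ) → ℕ
sumWords zero h = h []
sumWords (suc l) h = sumWords l (h ∘ (U ∷_)) + sumWords l (h ∘ (D ∷_)) + sumWords l (h ∘ (L ∷_))

sumWords-cong : ∀ l {f g : Word → ℕ} → (∀ w → length w ≡ l → f w ≡ g w) → sumWords l f ≡ sumWords l g
sumWords-cong zero f≗g = f≗g [] refl
sumWords-cong (suc l) f≗g =
  cong₂ _+_ (cong₂ _+_ (sumWords-cong l (λ w e → f≗g (U ∷ w) (cong suc e)))
                       (sumWords-cong l (λ w e → f≗g (D ∷ w) (cong suc e))))
            (sumWords-cong l (λ w e → f≗g (L ∷ w) (cong suc e)))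

sumWords-zero : ∀ l → sumWords l (λ _ → 0) ≡ 0
sumWords-zero zero = refl
sumWords-zero (suc l) = cong₂ _+_ (cong₂ _+_ (sumWords-zero l) (sumWords-zero l)) (sumWords-zero l)

sumWords-sumComps : ∀ l n M (F : Word → List ℕ → ℕ) →
                    sumWords l (λ w → sumComps n M (F w)) ≡ sumComps n M (λ a → sumWords l (λ w → F w a))
sumWords-sumComps zero n M F = refl
sumWords-sumComps (suc l) n M F =
  trans (cong₂ _+_ (cong₂ _+_ (sumWords-sumComps l n M _) (sumWords-sumComps l n M _)) (sumWords-sumComps l n M _))
        (trans (cong (_+ sumComps n M (λ a → sumWords l (λ w → F (L ∷ w) a))) (sym (sumComps-+ n M _ _)))
               (sym (sumComps-+ n M _ _)))

sumWords-δ : ∀ y → sumWords (length y) (λ w → 𝟙 (does (w ≟ʷ y))) ≡ 1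
sumWords-δ [] = refl
sumWords-δ (U ∷ y) = cong₂ _+_ (cong₂ _+_ (sumWords-δ y) (sumWords-zero (length y))) (sumWords-zero (length y))
sumWords-δ (D ∷ y) = cong₂ _+_ (cong₂ _+_ (sumWords-zero (length y)) (sumWords-δ y)) (sumWords-zero (length y))
sumWords-δ (L ∷ y) = cong₂ _+_ (cong₂ _+_ (sumWords-zero (length y)) (sumWords-zero (length y))) (sumWords-δ y)

length-filterᵇ-∷ : ∀ {A : Set} (p : A → Bool) x xs → length (filterᵇ p (x ∷ xs)) ≡ 𝟙 (p x) + length (filterᵇ p xs)
length-filterᵇ-∷ p x xs with p x
... | true = refl
... | false = refl

length-filterᵇ-filterᵇ : ∀ {A : Set} (p q : A → Bool) xs →
                         length (filterᵇ p (filterᵇ q xs)) ≡ length (filterᵇ (λ x → q x ∧ p x) xs)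
length-filterᵇ-filterᵇ p q [] = refl
length-filterᵇ-filterᵇ p q (x ∷ xs) with q x
... | false = length-filterᵇ-filterᵇ p q xs
... | true with p x
...   | true = cong suc (length-filterᵇ-filterᵇ p q xs)
...   | false = length-filterᵇ-filterᵇ p q xs

length-filterᵇ-allWords : ∀ l (p : Word → Bool) → length (filterᵇ p (allWords l)) ≡ sumWords l (𝟙 ∘ p)
length-filterᵇ-allWords zero p with p []
... | true = refl
... | false = refl
length-filterᵇ-allWords (suc l) p = trans (by-first-step (allWords l))
  (cong₂ _+_ (cong₂ _+_ (length-filterᵇ-allWords l _) (length-filterᵇ-allWords l _)) (length-filterᵇ-allWords l _))
  where
  matches : (Word → Bool) → List Word → ℕ
  matches q ws = length (filterᵇ q ws)
  by-first-step : ∀ ws → matches p (concatMap (λ w → (U ∷ w) ∷ (D ∷ w) ∷ (L ∷ w) ∷ []) ws)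
                         ≡ matches (p ∘ (U ∷_)) ws + matches (p ∘ (D ∷_)) ws + matches (p ∘ (L ∷_)) ws
  by-first-step [] = refl
  by-first-step (w ∷ ws) = begin
    matches p ((U ∷ w) ∷ (D ∷ w) ∷ (L ∷ w) ∷ rest)
      ≡⟨ length-filterᵇ-∷ p _ _ ⟩
    u + matches p ((D ∷ w) ∷ (L ∷ w) ∷ rest)
      ≡⟨ cong (u +_) (length-filterᵇ-∷ p _ _) ⟩
    u + (d + matches p ((L ∷ w) ∷ rest))
      ≡⟨ cong (λ z → u + (d + z)) (length-filterᵇ-∷ p _ _) ⟩
    u + (d + (ℓ + matches p rest))
      ≡⟨ cong (λ z → u + (d + (ℓ + z))) (by-first-step ws) ⟩
    u + (d + (ℓ + (U-rest + D-rest + L-rest)))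
      ≡⟨ regroup u d ℓ U-rest D-rest L-rest ⟩
    (u + U-rest) + (d + D-rest) + (ℓ + L-rest)
      ≡⟨ cong₂ _+_ (cong₂ _+_ (length-filterᵇ-∷ (p ∘ (U ∷_)) w ws) (length-filterᵇ-∷ (p ∘ (D ∷_)) w ws))
                   (length-filterᵇ-∷ (p ∘ (L ∷_)) w ws) ⟨
    matches (p ∘ (U ∷_)) (w ∷ ws) + matches (p ∘ (D ∷_)) (w ∷ ws) + matches (p ∘ (L ∷_)) (w ∷ ws) ∎
    where
    open ≡-Reasoning
    rest = concatMap (λ w → (U ∷ w) ∷ (D ∷ w) ∷ (L ∷ w) ∷ []) ws
    u = 𝟙 (p (U ∷ w))
    d = 𝟙 (p (D ∷ w))
    ℓ = 𝟙 (p (L ∷ w))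
    U-rest = matches (p ∘ (U ∷_)) ws
    D-rest = matches (p ∘ (D ∷_)) ws
    L-rest = matches (p ∘ (L ∷_)) ws
    regroup : ∀ a b c x y z → a + (b + (c + (x + y + z))) ≡ (a + x) + (b + y) + (c + z)
    regroup = solve-∀

sumWords-valid≡sumComps-good : ∀ l n M (encode : List ℕ → Word) (good : List ℕ → Bool) (valid : Word → Bool) →
  (∀ {a a′} → encode a ≡ encode a′ → a ≡ a′) →
  (∀ a → length a ≡ n → sum a ≡ M → good a ≡ true → length (encode a) ≡ l × valid (encode a) ≡ true) →
  (∀ w → length w ≡ l → valid w ≡ true →
         ∃ λ a → length a ≡ n × sum a ≡ M × good a ≡ true × w ≡ encode a) →
  sumWords l (𝟙 ∘ valid) ≡ sumComps n M (𝟙 ∘ good)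
sumWords-valid≡sumComps-good l n M encode good valid injective good⇒valid valid⇒good = begin
  sumWords l (𝟙 ∘ valid)                  ≡⟨ sumWords-cong l fibre ⟩
  sumWords l (λ w → sumComps n M (δ w))   ≡⟨ sumWords-sumComps l n M δ ⟩
  sumComps n M (λ a → sumWords l (λ w → δ w a)) ≡⟨ sumComps-cong n M image ⟩
  sumComps n M (𝟙 ∘ good)                 ∎
  where
  open ≡-Reasoning
  δ : Word → List ℕ → ℕ
  δ w a = 𝟙 (good a ∧ does (w ≟ʷ encode a))

  image : ∀ a → length a ≡ n → sum a ≡ M → sumWords l (λ w → δ w a) ≡ 𝟙 (good a)
  image a ∣a∣≡n Σa≡M with good a in good[a]
  ... | false = sumWords-zero l
  ... | true = subst (λ l → sumWords l (λ w → 𝟙 (does (w ≟ʷ encode a))) ≡ 1)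
                     (proj₁ (good⇒valid a ∣a∣≡n Σa≡M good[a])) (sumWords-δ (encode a))

  fibre : ∀ w → length w ≡ l → 𝟙 (valid w) ≡ sumComps n M (δ w)
  fibre w ∣w∣≡l with valid w in valid[w]
  ... | false = sym (trans (sumComps-cong n M none) (sumComps-zero n M))
    where
    none : ∀ a → length a ≡ n → sum a ≡ M → δ w a ≡ 0
    none a ∣a∣≡n Σa≡M with good a in good[a] | w ≟ʷ encode a
    ... | false | _ = refl
    ... | true | no _ = refl
    ... | true | yes refl = ⊥-elim (false≢true (trans (sym valid[w]) (proj₂ (good⇒valid a ∣a∣≡n Σa≡M good[a]))))
      where
      false≢true : false ≢ true
      false≢true ()
  ... | true with valid⇒good w ∣w∣≡l valid[w]
  ...   | a₀ , ∣a₀∣≡n , Σa₀≡M , good[a₀] , refl =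
    sym (trans (sumComps-cong n M single)
               (subst₂ (λ n M → sumComps n M (λ a → 𝟙 (does (a ≟ₗ a₀))) ≡ 1)
                       ∣a₀∣≡n Σa₀≡M (sumComps-δ a₀)))
    where
    single : ∀ a → length a ≡ n → sum a ≡ M → δ (encode a₀) a ≡ 𝟙 (does (a ≟ₗ a₀))
    single a _ _ with a ≟ₗ a₀ | encode a₀ ≟ʷ encode a
    ... | yes refl | yes _ = cong (λ g → 𝟙 (g ∧ true)) good[a₀]
    ... | yes refl | no e≢e = ⊥-elim (e≢e refl)
    ... | no _ | no _ = cong 𝟙 (∧-zeroʳ (good a))
    ... | no a≢a₀ | yes e = ⊥-elim (a≢a₀ (sym (injective e)))

upSteps : Word → ℕ
upSteps [] = 0
upSteps (U ∷ w) = suc (upSteps w)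
upSteps (D ∷ w) = upSteps w
upSteps (L ∷ w) = upSteps w

downSteps : Word → ℕ
downSteps [] = 0
downSteps (U ∷ w) = downSteps w
downSteps (D ∷ w) = suc (downSteps w)
downSteps (L ∷ w) = suc (downSteps w)

length≡upSteps+downSteps : ∀ w → length w ≡ upSteps w + downSteps w
length≡upSteps+downSteps [] = refl
length≡upSteps+downSteps (U ∷ w) = cong suc (length≡upSteps+downSteps w)
length≡upSteps+downSteps (D ∷ w) = trans (cong suc (length≡upSteps+downSteps w)) (sym (+-suc (upSteps w) _))
length≡upSteps+downSteps (L ∷ w) = trans (cong suc (length≡upSteps+downSteps w)) (sym (+-suc (upSteps w) _))

heightOK⇒balanced : ∀ h w → heightOK h w ≡ true → h + upSteps w ≡ downSteps w
heightOK⇒balanced zero [] _ = refl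
heightOK⇒balanced h (U ∷ w) e = trans (+-suc h (upSteps w)) (heightOK⇒balanced (suc h) w e)
heightOK⇒balanced (suc h) (D ∷ w) e = cong suc (heightOK⇒balanced h w e)
heightOK⇒balanced (suc h) (L ∷ w) e = cong suc (heightOK⇒balanced h w e)

heightOK-U^ : ∀ h x w → heightOK h (replicate x U ++ w) ≡ heightOK (h + x) w
heightOK-U^ h zero w = cong (λ h → heightOK h w) (sym (+-identityʳ h))
heightOK-U^ h (suc x) w = trans (heightOK-U^ (suc h) x w) (cong (λ h → heightOK h w) (sym (+-suc h x)))

≤ᵇ-suc : ∀ j g → (suc j ≤ᵇ suc g) ≡ (j ≤ᵇ g)
≤ᵇ-suc zero g = refl
≤ᵇ-suc (suc j) g = refl

heightOK-D^L : ∀ j g z → heightOK (suc g) (replicate j D ++ L ∷ z) ≡ (j ≤ᵇ g) ∧ heightOK (g ∸ j) z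
heightOK-D^L zero g z = refl
heightOK-D^L (suc j) zero z = helper j
  where
  helper : ∀ j → heightOK 0 (replicate j D ++ L ∷ z) ≡ false
  helper zero = refl
  helper (suc j) = refl
heightOK-D^L (suc j) (suc g) z = trans (heightOK-D^L j g z) (cong (_∧ heightOK (g ∸ j) z) (sym (≤ᵇ-suc j g)))

≤ᵇ-∧-∸≡ᵇ0 : ∀ j g → ((j ≤ᵇ g) ∧ (g ∸ j ≡ᵇ 0)) ≡ (g ≡ᵇ j)
≤ᵇ-∧-∸≡ᵇ0 zero zero = refl
≤ᵇ-∧-∸≡ᵇ0 zero (suc g) = refl
≤ᵇ-∧-∸≡ᵇ0 (suc j) zero = refl
≤ᵇ-∧-∸≡ᵇ0 (suc j) (suc g) = trans (cong (_∧ (g ∸ j ≡ᵇ 0)) (≤ᵇ-suc j g)) (≤ᵇ-∧-∸≡ᵇ0 j g)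

≤ᵇ-∧-heightOK-D : ∀ j g w →
  ((j ≤ᵇ g) ∧ heightOK (g ∸ j) (D ∷ w)) ≡ ((suc j ≤ᵇ g) ∧ heightOK (g ∸ suc j) w)
≤ᵇ-∧-heightOK-D zero zero w = refl
≤ᵇ-∧-heightOK-D zero (suc g) w = refl
≤ᵇ-∧-heightOK-D (suc j) zero w = refl
≤ᵇ-∧-heightOK-D (suc j) (suc g) w =
  trans (cong (_∧ heightOK (g ∸ j) (D ∷ w)) (≤ᵇ-suc j g))
        (trans (≤ᵇ-∧-heightOK-D j g w) (cong (_∧ heightOK (g ∸ suc j) w) (sym (≤ᵇ-suc (suc j) g))))

noULLU-D^L : ∀ j z → noULLU (replicate j D ++ L ∷ z) ≡ noULLU (L ∷ z)
noULLU-D^L zero z = refl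
noULLU-D^L (suc j) z = noULLU-D^L j z

startsWithU : Word → Bool
startsWithU (U ∷ _) = true
startsWithU _ = false

noULLU-L∷ : ∀ w → noULLU (L ∷ w) ≡ true → startsWithU w ≡ false × noULLU w ≡ true
noULLU-L∷ [] e = refl , refl
noULLU-L∷ (D ∷ w) e = refl , e
noULLU-L∷ (L ∷ w) e = refl , e

noULLU-U∷ : ∀ w → noULLU (U ∷ w) ≡ true → noULLU w ≡ true
noULLU-U∷ [] e = refl
noULLU-U∷ (U ∷ w) e = e
noULLU-U∷ (D ∷ w) e = e

𝟙≤1 : ∀ b → 𝟙 b ≤ 1
𝟙≤1 true = ≤-refl
𝟙≤1 false = z≤n

m+m≡n+n⇒m≡n : ∀ m n → m + m ≡ n + n → m ≡ n
m+m≡n+n⇒m≡n zero zero e = refl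
m+m≡n+n⇒m≡n (suc m) (suc n) e =
  cong suc (m+m≡n+n⇒m≡n m n (suc-injective (trans (sym (+-suc m m)) (trans (suc-injective e) (+-suc n n)))))

-- Box paths

module BoxPaths (k₀ : ℕ) where

  k = suc k₀

  open Ballot k

  box : Word → Word
  box z = U ∷ replicate k D ++ L ∷ z

  encode encodeTail : List ℕ → Word
  encode [] = []
  encode (x ∷ r) = replicate x U ++ box (encodeTail r)
  encodeTail [] = []
  encodeTail (y ∷ r) = D ∷ encode (y ∷ r)

  encode-injective : ∀ {a a′} → encode a ≡ encode a′ → a ≡ a′
  encodeTail-injective : ∀ {r r′} → encodeTail r ≡ encodeTail r′ → r ≡ r′
  encode-injective {[]} {[]} e = refl
  encode-injective {[]} {zero ∷ _} ()
  encode-injective {[]} {suc _ ∷ _} ()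
  encode-injective {zero ∷ _} {[]} ()
  encode-injective {suc _ ∷ _} {[]} ()
  encode-injective {zero ∷ r} {zero ∷ r′} e =
    cong (0 ∷_) (encodeTail-injective (∷-injectiveʳ (++-cancelˡ (replicate k D) _ _ (∷-injectiveʳ e))))
  encode-injective {zero ∷ r} {suc zero ∷ r′} ()
  encode-injective {zero ∷ r} {suc (suc _) ∷ r′} ()
  encode-injective {suc zero ∷ r} {zero ∷ r′} ()
  encode-injective {suc (suc _) ∷ r} {zero ∷ r′} ()
  encode-injective {suc x ∷ r} {suc x′ ∷ r′} e with encode-injective {x ∷ r} {x′ ∷ r′} (∷-injectiveʳ e)
  ... | refl = refl
  encodeTail-injective {[]} {[]} e = refl
  encodeTail-injective {y ∷ r} {y′ ∷ r′} e = encode-injective (∷-injectiveʳ e)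

  noULLU-encode : ∀ a → noULLU (encode a) ≡ true
  noULLU-encode [] = refl
  noULLU-encode (x ∷ r) = trans (ascent x) (trans (noULLU-D^L k₀ (encodeTail r)) (tail r))
    where
    ascent : ∀ x → noULLU (replicate x U ++ box (encodeTail r)) ≡ noULLU (box (encodeTail r))
    ascent zero = refl
    ascent (suc zero) = refl
    ascent (suc (suc x)) = ascent (suc x)
    tail : ∀ r → noULLU (L ∷ encodeTail r) ≡ true
    tail [] = refl
    tail (y ∷ r) = noULLU-encode (y ∷ r)

  heightOK-encode : ∀ h x r → heightOK h (encode (x ∷ r)) ≡ isBallot h (x ∷ r)
  heightOK-encode h x r = trans (heightOK-U^ h x (box (encodeTail r))) (trans (heightOK-D^L k (h + x) (encodeTail r)) (tail r))
    where
    tail : ∀ r → ((k ≤ᵇ h + x) ∧ heightOK (h + x ∸ k) (encodeTail r)) ≡ isBallot h (x ∷ r)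
    tail [] = ≤ᵇ-∧-∸≡ᵇ0 k (h + x)
    tail (y ∷ r) = trans (≤ᵇ-∧-heightOK-D k (h + x) _) (cong ((suc k ≤ᵇ h + x) ∧_) (heightOK-encode _ y r))

  occ : Word → ℕ
  occ = occurrences (boxFactor k)

  occ-D^L : ∀ j z → occ (replicate j D ++ L ∷ z) ≡ occ z
  occ-D^L zero z = refl
  occ-D^L (suc j) z = occ-D^L j z

  isPrefix-D^L : ∀ j z → isPrefix (replicate j D ++ L ∷ []) (replicate j D ++ L ∷ z) ≡ true
  isPrefix-D^L zero z = refl
  isPrefix-D^L (suc j) z = isPrefix-D^L j z

  occ-encode : ∀ a → occ (encode a) ≡ length a
  occ-encode [] = refl
  occ-encode (x ∷ r) = trans (ascent x) (cong suc (tail r))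
    where
    ascent : ∀ x → occ (replicate x U ++ box (encodeTail r)) ≡ suc (occ (encodeTail r))
    ascent zero = cong₂ (λ b o → 𝟙 b + o) (isPrefix-D^L k (encodeTail r)) (occ-D^L k (encodeTail r))
    ascent (suc zero) = ascent zero
    ascent (suc (suc x)) = ascent (suc x)
    tail : ∀ r → occ (encodeTail r) ≡ length r
    tail [] = refl
    tail (y ∷ r) = occ-encode (y ∷ r)

  longAscents-encode : ∀ a → longAscents (encode a) ≡ nonzeros a
  longAscents-encode [] = refl
  longAscents-encode (x ∷ r) =
    trans (ascent x) (trans (cong (nonzeros (x ∷ []) +_) (tail r)) (sym (nonzeros-++ (x ∷ []) r)))
    where
    descent : ∀ b j z → longAscentsFrom b (replicate j D ++ L ∷ z) ≡ longAscentsFrom false z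
    descent false zero z = refl
    descent true zero z = refl
    descent false (suc j) z = descent false j z
    descent true (suc j) z = descent false j z
    inside : ∀ x → longAscentsFrom true (replicate x U ++ box (encodeTail r)) ≡ longAscentsFrom false (encodeTail r)
    inside zero = descent true k (encodeTail r)
    inside (suc x) = inside x
    ascent : ∀ x → longAscentsFrom false (replicate x U ++ box (encodeTail r))
                   ≡ nonzeros (x ∷ []) + longAscentsFrom false (encodeTail r)
    ascent zero = descent true k (encodeTail r)
    ascent (suc zero) = cong suc (inside zero)
    ascent (suc (suc x)) = cong suc (inside (suc x))
    tail : ∀ r → longAscentsFrom false (encodeTail r) ≡ nonzeros r
    tail [] = refl
    tail (y ∷ r) = longAscents-encode (y ∷ r)

  downSteps-D^L : ∀ j z → downSteps (replicate j D ++ L ∷ z) ≡ suc (j + downSteps z)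
  downSteps-D^L zero z = refl
  downSteps-D^L (suc j) z = cong suc (downSteps-D^L j z)

  downSteps-encode : ∀ x r → suc (downSteps (encode (x ∷ r))) ≡ (2 + k) * length (x ∷ r)
  downSteps-encode x r = trans (cong suc (trans (ascent x) (downSteps-D^L k (encodeTail r)))) (tail r)
    where
    ascent : ∀ x → downSteps (replicate x U ++ box (encodeTail r)) ≡ downSteps (box (encodeTail r))
    ascent zero = refl
    ascent (suc x) = ascent x
    tail : ∀ r → suc (suc (k + downSteps (encodeTail r))) ≡ (2 + k) * suc (length r)
    tail [] = trans (cong (λ z → suc (suc z)) (+-identityʳ k)) (sym (*-identityʳ (2 + k)))
    tail (y ∷ r) = trans (cong (λ z → suc (suc (k + z))) (downSteps-encode y r)) (sym (*-suc (2 + k) (suc (length r))))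

  -- Every factor U D^k L costs k + 1 down steps, and two of them are separated by at least one
  -- further down step, since a factor cannot be followed directly by U.
  occ-bound : ∀ w → noULLU w ≡ true → (2 + k) * occ w ≤ 𝟙 (startsWithU w) + downSteps w
  occ-bound-box : ∀ j w → noULLU w ≡ true → isPrefix (replicate j D ++ L ∷ []) w ≡ true →
                  suc j + (2 + k) * occ w ≤ downSteps w
  occ-bound-suc : ∀ w → noULLU w ≡ true → (2 + k) * occ w ≤ suc (downSteps w)
  occ-bound-¬U : ∀ w → noULLU w ≡ true → startsWithU w ≡ false → (2 + k) * occ w ≤ downSteps w
  occ-bound [] _ = ≤-reflexive (*-zeroʳ (2 + k))
  occ-bound (U ∷ w) e with isPrefix (replicate k D ++ L ∷ []) w in prefix
  ... | false = occ-bound-suc w (noULLU-U∷ w e)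
  ... | true = subst (_≤ suc (downSteps w)) (sym (*-suc (2 + k) (occ w)))
                     (s≤s (occ-bound-box k w (noULLU-U∷ w e) prefix))
  occ-bound (D ∷ w) e = occ-bound-suc w e
  occ-bound (L ∷ w) e with noULLU-L∷ w e
  ... | notU , e′ = m≤n⇒m≤1+n (occ-bound-¬U w e′ notU)
  occ-bound-box zero (L ∷ z) e _ with noULLU-L∷ z e
  ... | notU , e′ = s≤s (occ-bound-¬U z e′ notU)
  occ-bound-box (suc j) (D ∷ w) e prefix = s≤s (occ-bound-box j w e prefix)
  occ-bound-box zero [] _ ()
  occ-bound-box zero (U ∷ _) _ ()
  occ-bound-box zero (D ∷ _) _ ()
  occ-bound-box (suc j) [] _ ()
  occ-bound-box (suc j) (U ∷ _) _ ()
  occ-bound-box (suc j) (L ∷ _) _ ()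
  occ-bound-suc w e = ≤-trans (occ-bound w e) (+-monoˡ-≤ (downSteps w) (𝟙≤1 (startsWithU w)))
  occ-bound-¬U w e notU = subst (λ b → (2 + k) * occ w ≤ 𝟙 b + downSteps w) notU (occ-bound w e)

  -- Equality in the bound forces the shape of an encoding.
  tight⇒encode : ∀ w → noULLU w ≡ true → (2 + k) * occ w ≡ suc (downSteps w) → ∃₂ λ x r → w ≡ encode (x ∷ r)
  tight⇒encode-box : ∀ j w → noULLU w ≡ true → isPrefix (replicate j D ++ L ∷ []) w ≡ true →
                     suc j + (2 + k) * occ w ≡ downSteps w → ∃ λ r → w ≡ replicate j D ++ L ∷ encodeTail r
  tight⇒encodeTail : ∀ z → noULLU z ≡ true → startsWithU z ≡ false → (2 + k) * occ z ≡ downSteps z →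
                     ∃ λ r → z ≡ encodeTail r
  tight⇒encode [] _ tight = ⊥-elim (0≢1+n (trans (sym (*-zeroʳ (2 + k))) tight))
  tight⇒encode (U ∷ w) e tight with isPrefix (replicate k D ++ L ∷ []) w in prefix
  ... | false with tight⇒encode w (noULLU-U∷ w e) tight
  ...   | x , r , refl = suc x , r , refl
  tight⇒encode (U ∷ w) e tight | true
    with tight⇒encode-box k w (noULLU-U∷ w e) prefix (suc-injective (trans (sym (*-suc (2 + k) (occ w))) tight))
  ...   | r , refl = 0 , r , refl
  tight⇒encode (D ∷ w) e tight = ⊥-elim (1+n≰n (subst (_≤ suc (downSteps w)) tight (occ-bound-suc w e)))
  tight⇒encode (L ∷ w) e tight with noULLU-L∷ w e
  ... | notU , e′ = ⊥-elim (1+n≰n (≤-trans (n≤1+n _) (subst (_≤ downSteps w) tight (occ-bound-¬U w e′ notU))))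
  tight⇒encode-box zero (L ∷ z) e _ tight with noULLU-L∷ z e
  ... | notU , e′ with tight⇒encodeTail z e′ notU (suc-injective tight)
  ...   | r , refl = r , refl
  tight⇒encode-box (suc j) (D ∷ w) e prefix tight with tight⇒encode-box j w e prefix (suc-injective tight)
  ... | r , refl = r , refl
  tight⇒encode-box zero [] _ ()
  tight⇒encode-box zero (U ∷ _) _ ()
  tight⇒encode-box zero (D ∷ _) _ ()
  tight⇒encode-box (suc j) [] _ ()
  tight⇒encode-box (suc j) (U ∷ _) _ ()
  tight⇒encode-box (suc j) (L ∷ _) _ ()
  tight⇒encodeTail [] _ _ _ = [] , refl
  tight⇒encodeTail (D ∷ v) e _ tight with tight⇒encode v e tight
  ... | x , r , refl = x ∷ r , refl
  tight⇒encodeTail (L ∷ v) e _ tight with noULLU-L∷ v e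
  ... | notU , e′ = ⊥-elim (1+n≰n (subst (_≤ downSteps v) tight (occ-bound-¬U v e′ notU)))

  module _ (n j : ℕ) (1≤n : 1 ≤ n) where

    private
      m = (k + 2) * n ∸ 1
      M = (k + 1) * n ∸ 1

      valid : Word → Bool
      valid w = isSkewDyck w ∧ (isBoxPath k n w ∧ (longAscents w ≡ᵇ j))

      good : List ℕ → Bool
      good a = isBallot 0 a ∧ (nonzeros a ≡ᵇ j)

      [2+k]n≡1+m : (2 + k) * n ≡ suc m
      [2+k]n≡1+m = trans (cong (_* n) (+-comm 2 k)) (trans (sym (m∸n+n≡m 1≤[k+2]n)) (+-comm _ 1))
        where
        1≤[k+2]n : 1 ≤ (k + 2) * n
        1≤[k+2]n = *-mono-≤ {1} {k + 2} (s≤s z≤n) 1≤n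

      M+1≡[1+k]n : M + 1 ≡ suc k * n
      M+1≡[1+k]n = trans (m∸n+n≡m (*-mono-≤ {1} {k + 1} (s≤s z≤n) 1≤n)) (cong (_* n) (+-comm k 1))

      valid-parts : ∀ w → valid w ≡ true →
                    noULLU w ≡ true × heightOK 0 w ≡ true × occ w ≡ n × (longAscents w ≡ᵇ j) ≡ true
      valid-parts w v = ∧-conicalˡ (noULLU w) _ skew , ∧-conicalʳ (noULLU w) _ skew
                      , ≡true⇒≡ (∧-conicalˡ (isBoxPath k n w) _ rest) , ∧-conicalʳ (isBoxPath k n w) _ rest
        where
        skew = ∧-conicalˡ (isSkewDyck w) _ v
        rest = ∧-conicalʳ (isSkewDyck w) _ v

      good⇒valid : ∀ a → length a ≡ n → sum a ≡ M → good a ≡ true →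
                   length (encode a) ≡ m + m × valid (encode a) ≡ true
      good⇒valid [] ∣a∣≡n _ _ = ⊥-elim (<⇒≱ 1≤n (≤-reflexive (sym ∣a∣≡n)))
      good⇒valid a@(x ∷ r) ∣a∣≡n _ g = ∣encode∣≡m+m , cong₂ _∧_ (cong₂ _∧_ (noULLU-encode a) height) boxes∧ascents
        where
        height : heightOK 0 (encode a) ≡ true
        height = trans (heightOK-encode 0 x r) (∧-conicalˡ (isBallot 0 a) _ g)
        downs≡m : downSteps (encode a) ≡ m
        downs≡m = suc-injective (trans (downSteps-encode x r) (trans (cong ((2 + k) *_) ∣a∣≡n) [2+k]n≡1+m))
        ∣encode∣≡m+m : length (encode a) ≡ m + m
        ∣encode∣≡m+m = trans (length≡upSteps+downSteps (encode a))
          (cong₂ _+_ (trans (heightOK⇒balanced 0 (encode a) height) downs≡m) downs≡m)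
        boxes∧ascents : (isBoxPath k n (encode a) ∧ (longAscents (encode a) ≡ᵇ j)) ≡ true
        boxes∧ascents = cong₂ _∧_ (≡⇒≡true (trans (occ-encode a) ∣a∣≡n))
                                  (trans (cong (_≡ᵇ j) (longAscents-encode a)) (∧-conicalʳ (isBallot 0 a) _ g))

      valid⇒good : ∀ w → length w ≡ m + m → valid w ≡ true →
                   ∃ λ a → length a ≡ n × sum a ≡ M × good a ≡ true × w ≡ encode a
      valid⇒good w ∣w∣≡m+m v with valid-parts w v
      ... | noULLU[w] , height , boxes , ascents with tight⇒encode w noULLU[w] tight
        where
        downs≡m : downSteps w ≡ m
        downs≡m = m+m≡n+n⇒m≡n _ _ (trans (sym (trans (length≡upSteps+downSteps w)
          (cong (_+ downSteps w) (heightOK⇒balanced 0 w height)))) ∣w∣≡m+m)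
        tight : (2 + k) * occ w ≡ suc (downSteps w)
        tight = trans (cong ((2 + k) *_) boxes) (trans [2+k]n≡1+m (cong suc (sym downs≡m)))
      ...   | x , r , refl = x ∷ r , ∣a∣≡n , Σa≡M , cong₂ _∧_ ballot nonzeros≡j , refl
        where
        a = x ∷ r
        ∣a∣≡n : length a ≡ n
        ∣a∣≡n = trans (sym (occ-encode a)) boxes
        ballot : isBallot 0 a ≡ true
        ballot = trans (sym (heightOK-encode 0 x r)) height
        nonzeros≡j : (nonzeros a ≡ᵇ j) ≡ true
        nonzeros≡j = trans (cong (_≡ᵇ j) (sym (longAscents-encode a))) ascents
        Σa≡M : sum a ≡ M
        Σa≡M = trans (sym (m+n∸n≡m (sum a) 1))
          (cong (_∸ 1) (trans (isBallot-sum 0 a ballot) (trans (cong (suc k *_) ∣a∣≡n) (cong (_* n) (+-comm 1 k)))))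

    numBoxPathsLongAsc≡ballots : numBoxPathsLongAsc k n j ≡ sumComps n M (𝟙 ∘ good)
    numBoxPathsLongAsc≡ballots = begin
      numBoxPathsLongAsc k n j
        ≡⟨ length-filterᵇ-filterᵇ _ _ (skewDyckPaths m) ⟩
      length (filterᵇ (λ w → isBoxPath k n w ∧ (longAscents w ≡ᵇ j)) (skewDyckPaths m))
        ≡⟨ length-filterᵇ-filterᵇ _ _ (allWords (m + m)) ⟩
      length (filterᵇ valid (allWords (m + m)))
        ≡⟨ length-filterᵇ-allWords (m + m) valid ⟩
      sumWords (m + m) (𝟙 ∘ valid)
        ≡⟨ sumWords-valid≡sumComps-good (m + m) n M encode good valid encode-injective good⇒valid valid⇒good ⟩
      sumComps n M (𝟙 ∘ good) ∎
      where open ≡-Reasoning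

    n*numBoxPathsLongAsc : n * numBoxPathsLongAsc k n j ≡ (n C j) * positiveComps M j
    n*numBoxPathsLongAsc = begin
      n * numBoxPathsLongAsc k n j              ≡⟨ cong (n *_) numBoxPathsLongAsc≡ballots ⟩
      n * sumComps n M (𝟙 ∘ good)               ≡⟨ n*ballots≡compositions n M j 1≤n M+1≡[1+k]n ⟩
      sumComps n M (λ a → 𝟙 (nonzeros a ≡ᵇ j))  ≡⟨ sumComps-nonzeros n M j ⟩
      (n C j) * positiveComps M j               ∎
      where open ≡-Reasoning

cancel-by-absorption : ∀ n j X B → suc n * X ≡ (suc n C suc j) * B → suc j * X ≡ B * (n C j)
cancel-by-absorption n j X B [1+n]X≡ = *-cancelˡ-≡ (suc j * X) (B * (n C j)) (suc n) (begin
  suc n * (suc j * X)             ≡⟨ swap (suc n) (suc j) X ⟩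
  suc j * (suc n * X)             ≡⟨ cong (suc j *_) [1+n]X≡ ⟩
  suc j * ((suc n C suc j) * B)   ≡⟨ *-assoc (suc j) (suc n C suc j) B ⟨
  (suc j * (suc n C suc j)) * B   ≡⟨ cong (_* B) ([1+k]*[1+n]C[1+k]≡[1+n]*nCk n j) ⟩
  (suc n * (n C j)) * B           ≡⟨ swap′ (suc n) (n C j) B ⟩
  suc n * (B * (n C j))           ∎)
  where
  open ≡-Reasoning
  swap : ∀ x y z → x * (y * z) ≡ y * (x * z)
  swap = solve-∀
  swap′ : ∀ x y z → (x * y) * z ≡ x * (z * y)
  swap′ = solve-∀

theorem7p2 : ∀ (k n j : ℕ) → 1 ≤ k → 1 ≤ n → 1 ≤ j → j ≤ n →
    j * numBoxPathsLongAsc k n j ≡ (((k + 1) * n ∸ 2) C (j ∸ 1)) * ((n ∸ 1) C (j ∸ 1))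
theorem7p2 (suc k₀) (suc n₀) (suc j₀) _ 1≤n _ _ =
  cancel-by-absorption n₀ j₀ (numBoxPathsLongAsc k n j) (M′ C j₀) (begin
    n * numBoxPathsLongAsc k n j         ≡⟨ n*numBoxPathsLongAsc n j 1≤n ⟩
    (n C j) * positiveComps M j          ≡⟨ cong (λ M → (n C j) * positiveComps M j) M≡1+M′ ⟩
    (n C j) * positiveComps (suc M′) j   ≡⟨ cong ((n C j) *_) (positiveComps-suc M′ j₀) ⟩
    (n C j) * (M′ C j₀)                  ∎)
  where
  open BoxPaths k₀
  open ≡-Reasoning
  n = suc n₀
  j = suc j₀
  M = (k + 1) * n ∸ 1
  M′ = (k + 1) * n ∸ 2
  M≡1+M′ : M ≡ suc M′
  M≡1+M′ = ∸1≡1+∸2 (*-mono-≤ {2} {k + 1} (+-monoˡ-≤ 1 (s≤s z≤n)) 1≤n)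
    where
    ∸1≡1+∸2 : ∀ {m} → 2 ≤ m → m ∸ 1 ≡ suc (m ∸ 2)
    ∸1≡1+∸2 (s≤s (s≤s _)) = refl
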